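{- Let $m$ be an odd positive integer not divisible by $3$ and let $a,d_1,d_2,d_3\in\mathbb{Z}/m\mathbb{Z}$ be such that $d_1$, $d_2$, $d_3$, $d_2-d_1$, $d_3-d_2$ and $d_1-d_3$ are invertible. Then the arithmetic tetrahedron $\mathrm{AS}(a,(d_1,d_2,d_3),s)$ is balanced for all positive integers $s\equiv 0$, $-1$ or $-2\pmod m$.
   Context: $\mathrm{AS}(a,(d_1,d_2,d_3),s)=\{a+i_1d_1+i_2d_2+i_3d_3: i\in\mathbb{N}^3,\ i_1+i_2+i_3\le s-1\}$ as a multiset of $\mathbb{Z}/m\mathbb{Z}$. A multiset is balanced if every element of $\mathbb{Z}/m\mathbb{Z}$ occurs in it with the same multiplicity. -}

module Defs where

open import Data.Nat using (ℕ; zero; suc; _+_; _*_; _∸_; _≤_; NonZero)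
open import Data.Nat.DivMod using (_%_)
open import Data.Fin using (Fin; toℕ)
open import Data.List using (List; []; _∷_; _++_; map; concatMap; upTo; length; filter)
open import Data.Product using (_×_; _,_; Σ; ∃)
open import Relation.Binary.PropositionalEquality using (_≡_)
open import Data.Nat using (_≟_)

Invertible : (m : ℕ) → .{{NonZero m}} → Fin m → Set
Invertible m x = ∃ λ (y : Fin m) → (toℕ x * toℕ y) % m ≡ 1 % m

diff : (m : ℕ) → .{{NonZero m}} → Fin m → Fin m → ℕ
diff m y x = (toℕ y + (m ∸ toℕ x)) % m

InvertibleNat : (m : ℕ) → .{{NonZero m}} → ℕ → Set
InvertibleNat m x = ∃ λ (y : ℕ) → (x * y) % m ≡ 1 % m

-- Index triples (i1,i2,i3) ∈ ℕ³ with i1 + i2 + i3 ≤ s - 1, i.e. i1+i2+i3 < s.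
indices : ℕ → List (ℕ × ℕ × ℕ)
indices s = concatMap (λ i₁ → concatMap (λ i₂ →
              map (λ i₃ → (i₁ , i₂ , i₃)) (upTo (s ∸ (i₁ + i₂))))
              (upTo (s ∸ i₁))) (upTo s)

asElem : (m : ℕ) → .{{NonZero m}} → Fin m → Fin m → Fin m → Fin m → ℕ × ℕ × ℕ → ℕ
asElem m a d₁ d₂ d₃ (i₁ , i₂ , i₃) =
  (toℕ a + i₁ * toℕ d₁ + i₂ * toℕ d₂ + i₃ * toℕ d₃) % m

-- The arithmetic tetrahedron AS(a,(d1,d2,d3),s) as a multiset (list) of residues.
AS : (m : ℕ) → .{{NonZero m}} → Fin m → Fin m → Fin m → Fin m → ℕ → List ℕ
AS m a d₁ d₂ d₃ s = map (asElem m a d₁ d₂ d₃) (indices s)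

count : ℕ → List ℕ → ℕ
count c xs = length (filter (λ x → x ≟ c) xs)

Balanced : (m : ℕ) → List ℕ → Set
Balanced m xs = (c c′ : Fin m) → count (toℕ c) xs ≡ count (toℕ c′) xs

module Submission where

open import Data.Bool using (Bool; true; false)
open import Data.Fin using (Fin; toℕ)
open import Data.Fin.Properties using (toℕ<n)
open import Data.Integer as ℤ using (ℤ; 0ℤ; 1ℤ)
  renaming (_+_ to _+ℤ_; _-_ to _-ℤ_; _*_ to _*ℤ_)
import Data.Integer.Properties as ℤP
open import Data.Integer.Tactic.RingSolver using (solve-∀)
open import Data.List using (List; []; _∷_; _++_; map; concatMap; upTo; applyUpTo)
open import Data.List.Relation.Unary.All using (All; []; _∷_)
open import Data.List.Relation.Unary.AllPairs using (AllPairs; []; _∷_)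
open import Data.Nat
  using (ℕ; zero; suc; _+_; _*_; _∸_; _%_; _<_; _≤_; _≟_; _≡ᵇ_; z≤n; s≤s; NonZero)
import Data.Nat.Properties as ℕP
open import Data.Nat.DivMod
  using (%-distribˡ-+; %-distribˡ-*; m%n%n≡m%n; m*n%n≡0; m%n<n; m<n⇒m%n≡m; [m+n]%n≡m%n)
import Data.Nat.Tactic.RingSolver as ℕ-Solver
open import Data.Product using (_×_; _,_; ∃)
open import Data.Sum using (_⊎_; inj₁; inj₂)
open import Function using (_∘_; _⇔_; mk⇔)
open import Level using (0ℓ)
open import Relation.Binary.Bundles using (Setoid)
import Relation.Binary.Reasoning.Setoid as SetoidReasoning
open import Relation.Binary.PropositionalEquality
open import Relation.Nullary using (does; ¬_)
open import Relation.Nullary.Decidable using (does-⇔)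

open import Algebra.Properties.AbelianGroup ℤP.+-0-abelianGroup using (⁻¹-anti-homo‿-)

open import Defs

-- In the group ring ℤ[ℤ/mℤ] the multiplicity function of AS(a,(d₁,d₂,d₃),s) is
-- x^a h_{s-1}(x^d₁, x^d₂, x^d₃, 1), where h_k is the complete homogeneous symmetric polynomial,
-- and a multiset is balanced iff its multiplicity function is constant.
-- If x^a w - x^b w is constant and d = b - a is a unit, then w is constant: w(c) - w(c - d) is a
-- constant K, summing it over a full cycle of translations by d gives m K = 0, and translations
-- by a unit act transitively. Together with the divided-difference identity
--   (x^a - x^b) h_k(a, b, M) = h_{k+1}(a, M) - h_{k+1}(b, M)
-- this shows, by induction on the number of variables, that h_{k+N} - h_k is constant whenever
-- N ≡ 0 (mod m) and the variables are pairwise apart by units (for one variable it vanishes).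
-- As h_{-1} = h_{-2} = h_{-3} = 0, the polynomial h_{s-1} is constant for s ≡ 0, -1, -2.

-- Integer sums over lists

private variable E F : Set

∑ : (E → ℤ) → List E → ℤ
∑ g []       = 0ℤ
∑ g (x ∷ xs) = g x +ℤ ∑ g xs

∑-cong : {g h : E → ℤ} → g ≗ h → ∀ xs → ∑ g xs ≡ ∑ h xs
∑-cong g≗h []       = refl
∑-cong g≗h (x ∷ xs) = cong₂ _+ℤ_ (g≗h x) (∑-cong g≗h xs)

∑-++ : ∀ (g : E → ℤ) xs ys → ∑ g (xs ++ ys) ≡ ∑ g xs +ℤ ∑ g ys
∑-++ g []       ys = sym (ℤP.+-identityˡ (∑ g ys))
∑-++ g (x ∷ xs) ys = trans (cong (g x +ℤ_) (∑-++ g xs ys)) (sym (ℤP.+-assoc (g x) _ _))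

∑-map : ∀ (g : F → ℤ) (f : E → F) xs → ∑ g (map f xs) ≡ ∑ (g ∘ f) xs
∑-map g f []       = refl
∑-map g f (x ∷ xs) = cong (g (f x) +ℤ_) (∑-map g f xs)

∑-concatMap : ∀ (g : F → ℤ) (f : E → List F) xs → ∑ g (concatMap f xs) ≡ ∑ (∑ g ∘ f) xs
∑-concatMap g f []       = refl
∑-concatMap g f (x ∷ xs) =
  trans (∑-++ g (f x) (concatMap f xs)) (cong (∑ g (f x) +ℤ_) (∑-concatMap g f xs))

∑-applyUpTo : ∀ (g : ℕ → ℤ) f n → ∑ g (applyUpTo f n) ≡ ∑ (g ∘ f) (upTo n)
∑-applyUpTo g f zero    = refl
∑-applyUpTo g f (suc n) =
  cong (g (f 0) +ℤ_) (trans (∑-applyUpTo g (f ∘ suc) n) (sym (∑-applyUpTo (g ∘ f) suc n)))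

∑-upTo-suc : ∀ (g : ℕ → ℤ) n → ∑ g (upTo (suc n)) ≡ g 0 +ℤ ∑ (g ∘ suc) (upTo n)
∑-upTo-suc g n = cong (g 0 +ℤ_) (∑-applyUpTo g suc n)

indicator : Bool → ℤ
indicator true  = 1ℤ
indicator false = 0ℤ

count-map : ∀ c (g : E → ℕ) xs → ℤ.+ count c (map g xs) ≡ ∑ (λ x → indicator (does (g x ≟ c))) xs
count-map c g []       = refl
count-map c g (x ∷ xs) with g x ≡ᵇ c  -- what does (g x ≟ c) computes to
... | true  = cong (1ℤ +ℤ_) (count-map c g xs)
... | false = trans (count-map c g xs) (sym (ℤP.+-identityˡ _))

module Residues (p : ℕ) where

  m : ℕ
  m = suc p

  0<m : 0 < m
  0<m = s≤s z≤n

  -- A record rather than an equation of remainders, so that x and y can be inferred.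
  infix 4 _≡ₘ_
  record _≡ₘ_ (x y : ℕ) : Set where
    constructor ⟨_⟩
    field %-≡ : x % m ≡ y % m
  open _≡ₘ_ public

  ≡ₘ-setoid : Setoid 0ℓ 0ℓ
  ≡ₘ-setoid = record
    { Carrier       = ℕ
    ; _≈_           = _≡ₘ_
    ; isEquivalence = record
      { refl  = ⟨ refl ⟩
      ; sym   = λ x≡y → ⟨ sym (%-≡ x≡y) ⟩
      ; trans = λ x≡y y≡z → ⟨ trans (%-≡ x≡y) (%-≡ y≡z) ⟩
      }
    }

  open Setoid ≡ₘ-setoid public using ()
    renaming (refl to ≡ₘ-refl; sym to ≡ₘ-sym; trans to ≡ₘ-trans)
  module ≡ₘ-Reasoning = SetoidReasoning ≡ₘ-setoid

  ≡⇒≡ₘ : ∀ {x y} → x ≡ y → x ≡ₘ y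
  ≡⇒≡ₘ x≡y = ⟨ cong (_% m) x≡y ⟩

  %-≡ₘ : ∀ x → x % m ≡ₘ x
  %-≡ₘ x = ⟨ m%n%n≡m%n x m ⟩

  ≡ₘ⇒%≡ : ∀ {x y} → x ≡ₘ y → y < m → x % m ≡ y
  ≡ₘ⇒%≡ x≡y y<m = trans (%-≡ x≡y) (m<n⇒m%n≡m y<m)

  +-congₘ : ∀ {a b c d} → a ≡ₘ b → c ≡ₘ d → a + c ≡ₘ b + d
  +-congₘ {a} {b} {c} {d} ⟨ a≡b ⟩ ⟨ c≡d ⟩ = ⟨ begin
    (a + c) % m             ≡⟨ %-distribˡ-+ a c m ⟩
    (a % m + c % m) % m     ≡⟨ cong₂ (λ u v → (u + v) % m) a≡b c≡d ⟩
    (b % m + d % m) % m     ≡⟨ %-distribˡ-+ b d m ⟨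
    (b + d) % m             ∎ ⟩
    where open ≡-Reasoning

  *-congₘ : ∀ {a b c d} → a ≡ₘ b → c ≡ₘ d → a * c ≡ₘ b * d
  *-congₘ {a} {b} {c} {d} ⟨ a≡b ⟩ ⟨ c≡d ⟩ = ⟨ begin
    (a * c) % m             ≡⟨ %-distribˡ-* a c m ⟩
    (a % m * (c % m)) % m   ≡⟨ cong₂ (λ u v → (u * v) % m) a≡b c≡d ⟩
    (b % m * (d % m)) % m   ≡⟨ %-distribˡ-* b d m ⟨
    (b * d) % m             ∎ ⟩
    where open ≡-Reasoning

  *m≡ₘ0 : ∀ k → k * m ≡ₘ 0
  *m≡ₘ0 k = ⟨ m*n%n≡0 k m ⟩

  -- Since p ≡ -1 (mod m), x + y * p stands for x - y without truncated subtraction.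
  +*p≡ₘ0 : ∀ x → x + x * p ≡ₘ 0
  +*p≡ₘ0 x = ≡ₘ-trans (≡⇒≡ₘ (sym (ℕP.*-suc x p))) (*m≡ₘ0 x)

  ≡ₘ⇒+*p≡ₘ0 : ∀ {x y} → x ≡ₘ y → x + y * p ≡ₘ 0
  ≡ₘ⇒+*p≡ₘ0 {y = y} x≡y = ≡ₘ-trans (+-congₘ x≡y ≡ₘ-refl) (+*p≡ₘ0 y)

  +*p≡ₘ0⇒≡ₘ : ∀ {x y} → x + y * p ≡ₘ 0 → x ≡ₘ y
  +*p≡ₘ0⇒≡ₘ {x} {y} x+yp≡0 = begin
    x                ≡⟨ ℕP.+-identityʳ x ⟨
    x + 0            ≈⟨ +-congₘ {x} ≡ₘ-refl (+*p≡ₘ0 y) ⟨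
    x + (y + y * p)  ≡⟨ cong (x +_) (ℕP.+-comm y (y * p)) ⟩
    x + (y * p + y)  ≡⟨ ℕP.+-assoc x (y * p) y ⟨
    (x + y * p) + y  ≈⟨ +-congₘ x+yp≡0 ≡ₘ-refl ⟩
    y                ∎
    where open ≡ₘ-Reasoning

  unit-multiples-reach : ∀ {d} → InvertibleNat m d → ∀ c c′ → ∃ λ j → c + j * d * p ≡ₘ c′
  unit-multiples-reach {d} (y , dy≡1) c c′ = X * y , +*p≡ₘ0⇒≡ₘ (begin
    c + X * y * d * p + c′ * p   ≡⟨ regroup c c′ p y d ⟩
    X + X * p * (d * y)          ≈⟨ +-congₘ {X} ≡ₘ-refl (*-congₘ {X * p} ≡ₘ-refl ⟨ dy≡1 ⟩) ⟩
    X + X * p * 1                ≡⟨ cong (X +_) (ℕP.*-identityʳ (X * p)) ⟩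
    X + X * p                    ≈⟨ +*p≡ₘ0 X ⟩
    0                            ∎)
    where
      open ≡ₘ-Reasoning
      X : ℕ
      X = c + c′ * p
      regroup : ∀ c c′ p y d → c + (c + c′ * p) * y * d * p + c′ * p
                             ≡ (c + c′ * p) + (c + c′ * p) * p * (d * y)
      regroup = ℕ-Solver.solve-∀

  -- Elements of the group ring ℤ[ℤ/mℤ], as functions on ℕ of which only the values at the
  -- residues c < m matter.
  Weights : Set
  Weights = ℕ → ℤ

  0ʷ : Weights
  0ʷ _ = 0ℤ

  δ : Weights
  δ x = indicator (does (x % m ≟ 0))

  infixl 6 _⊕_ _⊖_
  _⊕_ _⊖_ : Weights → Weights → Weights
  (f ⊕ g) x = f x +ℤ g x
  (f ⊖ g) x = f x -ℤ g x

  -- Multiplication by x^k: the translate c ↦ f (c - k).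
  shift : ℕ → Weights → Weights
  shift k f x = f ((x + k * p) % m)

  infix 4 _≗ₘ_
  _≗ₘ_ : Weights → Weights → Set
  f ≗ₘ g = ∀ {x} → x < m → f x ≡ g x

  Constant : Weights → Set
  Constant f = ∀ {c c′} → c < m → c′ < m → f c ≡ f c′

  cong-≡ₘ : ∀ (f : Weights) {x y} → x ≡ₘ y → f (x % m) ≡ f (y % m)
  cong-≡ₘ f x≡y = cong f (%-≡ x≡y)

  δ-cong : ∀ {x y} → x ≡ₘ y → δ x ≡ δ y
  δ-cong = cong-≡ₘ (λ r → indicator (does (r ≟ 0)))

  indicator-%≟ : ∀ v {c} → c < m → indicator (does (v % m ≟ c)) ≡ shift v δ c
  indicator-%≟ v {c} c<m = begin
    indicator (does (v % m ≟ c))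
      ≡⟨ cong indicator (does-⇔ v%m≡c⇔ (v % m ≟ c) ((c + v * p) % m ≟ 0)) ⟩
    indicator (does ((c + v * p) % m ≟ 0))
      ≡⟨ δ-cong (%-≡ₘ (c + v * p)) ⟨
    shift v δ c
      ∎
    where
      open ≡-Reasoning
      v%m≡c⇔ : v % m ≡ c ⇔ (c + v * p) % m ≡ 0
      v%m≡c⇔ = mk⇔
        (λ v%m≡c → %-≡ (≡ₘ⇒+*p≡ₘ0 {c} {v} (≡ₘ-trans (≡⇒≡ₘ (sym v%m≡c)) (%-≡ₘ v))))
        (λ c+vp≡0 → ≡ₘ⇒%≡ (≡ₘ-sym (+*p≡ₘ0⇒≡ₘ {c} {v} ⟨ c+vp≡0 ⟩)) c<m)

  shift-shift : ∀ a b f → shift a (shift b f) ≗ shift (a + b) f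
  shift-shift a b f x = cong-≡ₘ f (begin
    (x + a * p) % m + b * p  ≈⟨ +-congₘ (%-≡ₘ (x + a * p)) ≡ₘ-refl ⟩
    x + a * p + b * p        ≡⟨ ℕP.+-assoc x (a * p) (b * p) ⟩
    x + (a * p + b * p)      ≡⟨ cong (x +_) (ℕP.*-distribʳ-+ p a b) ⟨
    x + (a + b) * p          ∎)
    where open ≡ₘ-Reasoning

  shift-cong : ∀ {k k′} f → k ≡ₘ k′ → shift k f ≗ shift k′ f
  shift-cong f k≡k′ x = cong-≡ₘ f (+-congₘ {x} ≡ₘ-refl (*-congₘ k≡k′ ≡ₘ-refl))

  shift-comm : ∀ a b f → shift a (shift b f) ≗ shift b (shift a f)
  shift-comm a b f x = begin
    shift a (shift b f) x  ≡⟨ shift-shift a b f x ⟩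
    shift (a + b) f x      ≡⟨ shift-cong f (≡⇒≡ₘ (ℕP.+-comm a b)) x ⟩
    shift (b + a) f x      ≡⟨ shift-shift b a f x ⟨
    shift b (shift a f) x  ∎
    where open ≡-Reasoning

  shift-resp-≗ₘ : ∀ k {f g} → f ≗ₘ g → shift k f ≗ shift k g
  shift-resp-≗ₘ k f≗g x = f≗g (m%n<n (x + k * p) m)

  shift-≡ₘ0 : ∀ {k} f → k ≡ₘ 0 → shift k f ≗ₘ f
  shift-≡ₘ0 {k} f k≡0 {x} x<m = begin
    shift k f x        ≡⟨ shift-cong f k≡0 x ⟩
    f ((x + 0) % m)    ≡⟨ cong f (trans (cong (_% m) (ℕP.+-identityʳ x)) (m<n⇒m%n≡m x<m)) ⟩
    f x                ∎
    where open ≡-Reasoning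

  shift-undo : ∀ {a} f → a < m → shift (m ∸ a) (shift a f) ≗ₘ f
  shift-undo {a} f a<m {x} x<m = begin
    shift (m ∸ a) (shift a f) x  ≡⟨ shift-shift (m ∸ a) a f x ⟩
    shift (m ∸ a + a) f x        ≡⟨ shift-≡ₘ0 f m∸a+a≡0 x<m ⟩
    f x                          ∎
    where
      open ≡-Reasoning
      m∸a+a≡0 : m ∸ a + a ≡ₘ 0
      m∸a+a≡0 = ≡ₘ-trans (≡⇒≡ₘ (trans (ℕP.m∸n+n≡m (ℕP.<⇒≤ a<m)) (sym (ℕP.*-identityˡ m))))
                         (*m≡ₘ0 1)

  Constant-resp-≗ₘ : ∀ {f g} → f ≗ₘ g → Constant f → Constant g
  Constant-resp-≗ₘ f≗g f-const c<m c′<m =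
    trans (sym (f≗g c<m)) (trans (f-const c<m c′<m) (f≗g c′<m))

  Constant-⊖ : ∀ {f g} → Constant f → Constant g → Constant (f ⊖ g)
  Constant-⊖ f-const g-const c<m c′<m = cong₂ _-ℤ_ (f-const c<m c′<m) (g-const c<m c′<m)

  Constant-shift : ∀ k {f} → Constant f → Constant (shift k f)
  Constant-shift k f-const {c} {c′} _ _ = f-const (m%n<n (c + k * p) m) (m%n<n (c′ + k * p) m)

  Constant-⊖-comm : ∀ {f g} → Constant (f ⊖ g) → Constant (g ⊖ f)
  Constant-⊖-comm {f} {g} f⊖g-const {c} {c′} c<m c′<m = begin
    g c -ℤ f c         ≡⟨ ⁻¹-anti-homo‿- (f c) (g c) ⟨
    ℤ.- (f c -ℤ g c)   ≡⟨ cong ℤ.-_ (f⊖g-const c<m c′<m) ⟩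
    ℤ.- (f c′ -ℤ g c′) ≡⟨ ⁻¹-anti-homo‿- (f c′) (g c′) ⟩
    g c′ -ℤ f c′       ∎
    where open ≡-Reasoning

  -- Translation by a unit

  module _ (d : ℕ) (w : Weights) (w⊖shift-const : Constant (w ⊖ shift d w)) where

    private
      K : ℤ
      K = w 0 -ℤ shift d w 0

      step : ∀ {c} → c < m → w c ≡ shift d w c +ℤ K
      step {c} c<m = begin
        w c                                  ≡⟨ add-difference (w c) (shift d w c) ⟩
        shift d w c +ℤ (w c -ℤ shift d w c)  ≡⟨ cong (shift d w c +ℤ_) (w⊖shift-const c<m 0<m) ⟩
        shift d w c +ℤ K                     ∎
        where
          open ≡-Reasoning
          add-difference : ∀ a b → a ≡ b +ℤ (a -ℤ b)
          add-difference = solve-∀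

      iterate : ∀ j {c} → c < m → w c ≡ shift (j * d) w c +ℤ ℤ.+ j *ℤ K
      iterate zero    c<m = trans (sym (shift-≡ₘ0 w ≡ₘ-refl c<m)) (sym (ℤP.+-identityʳ _))
      iterate (suc j) {c} c<m = begin
        w c                                      ≡⟨ iterate j c<m ⟩
        shift (j * d) w c +ℤ jK                  ≡⟨ cong (_+ℤ jK) (step {c₁} (m%n<n (c + j * d * p) m)) ⟩
        shift (j * d) (shift d w) c +ℤ K +ℤ jK   ≡⟨ cong (λ z → z +ℤ K +ℤ jK) (shift-comm (j * d) d w c) ⟩
        shift d (shift (j * d) w) c +ℤ K +ℤ jK   ≡⟨ cong (λ z → z +ℤ K +ℤ jK) (shift-shift d (j * d) w c) ⟩
        shift (suc j * d) w c +ℤ K +ℤ jK         ≡⟨ collect (shift (suc j * d) w c) K (ℤ.+ j) ⟩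
        shift (suc j * d) w c +ℤ ℤ.+ suc j *ℤ K  ∎
        where
          open ≡-Reasoning
          c₁ : ℕ
          c₁ = (c + j * d * p) % m
          jK : ℤ
          jK = ℤ.+ j *ℤ K
          collect : ∀ a K J → a +ℤ K +ℤ J *ℤ K ≡ a +ℤ (1ℤ +ℤ J) *ℤ K
          collect = solve-∀

      -- Along a full cycle of translations by d the increments K add up to m K.
      K≡0 : K ≡ 0ℤ
      K≡0 = ℤP.*-cancelˡ-≡ (ℤ.+ m) K 0ℤ (begin
        ℤ.+ m *ℤ K
          ≡⟨ cancel-left (w 0) (ℤ.+ m *ℤ K) ⟩
        (w 0 +ℤ ℤ.+ m *ℤ K) -ℤ w 0
          ≡⟨ cong (λ z → (z +ℤ ℤ.+ m *ℤ K) -ℤ w 0) full-cycle ⟨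
        (shift (m * d) w 0 +ℤ ℤ.+ m *ℤ K) -ℤ w 0
          ≡⟨ cong (_-ℤ w 0) (iterate m 0<m) ⟨
        w 0 -ℤ w 0
          ≡⟨ ℤP.+-inverseʳ (w 0) ⟩
        0ℤ
          ≡⟨ ℤP.*-zeroʳ (ℤ.+ m) ⟨
        ℤ.+ m *ℤ 0ℤ
          ∎)
        where
          open ≡-Reasoning
          cancel-left : ∀ a X → X ≡ (a +ℤ X) -ℤ a
          cancel-left = solve-∀
          full-cycle : shift (m * d) w 0 ≡ w 0
          full-cycle = shift-≡ₘ0 w (≡ₘ-trans (≡⇒≡ₘ (ℕP.*-comm m d)) (*m≡ₘ0 d)) 0<m

    constant-difference⇒shift-invariant : ∀ j → w ≗ₘ shift (j * d) w
    constant-difference⇒shift-invariant j {c} c<m = begin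
      w c                               ≡⟨ iterate j c<m ⟩
      shift (j * d) w c +ℤ ℤ.+ j *ℤ K   ≡⟨ cong (λ z → shift (j * d) w c +ℤ ℤ.+ j *ℤ z) K≡0 ⟩
      shift (j * d) w c +ℤ ℤ.+ j *ℤ 0ℤ  ≡⟨ cong (shift (j * d) w c +ℤ_) (ℤP.*-zeroʳ (ℤ.+ j)) ⟩
      shift (j * d) w c +ℤ 0ℤ           ≡⟨ ℤP.+-identityʳ _ ⟩
      shift (j * d) w c                 ∎
      where open ≡-Reasoning

  shift-invariant⇒constant : ∀ d w → InvertibleNat m d → (∀ j → w ≗ₘ shift (j * d) w) →
                             Constant w
  shift-invariant⇒constant d w d-unit invariant {c} {c′} c<m c′<m
    with j , c-jd≡c′ ← unit-multiples-reach d-unit c c′ =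
    trans (invariant j c<m) (cong w (≡ₘ⇒%≡ c-jd≡c′ c′<m))

  constant-difference⇒constant : ∀ d w → InvertibleNat m d → Constant (w ⊖ shift d w) →
                                 Constant w
  constant-difference⇒constant d w d-unit w⊖shift-const =
    shift-invariant⇒constant d w d-unit (constant-difference⇒shift-invariant d w w⊖shift-const)

  constant-shift-difference⇒constant : ∀ a b w → a < m → InvertibleNat m ((b + (m ∸ a)) % m) →
                                       Constant (shift a w ⊖ shift b w) → Constant w
  constant-shift-difference⇒constant a b w a<m b-a-unit difference-const =
    constant-difference⇒constant b-a w b-a-unit
      (Constant-resp-≗ₘ shifted-back (Constant-shift (m ∸ a) difference-const))
    where
      b-a : ℕ
      b-a = (b + (m ∸ a)) % m
      shifted-back : shift (m ∸ a) (shift a w ⊖ shift b w) ≗ₘ w ⊖ shift b-a w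
      shifted-back {x} x<m = cong₂ _-ℤ_ (shift-undo w a<m x<m) (begin
        shift (m ∸ a) (shift b w) x  ≡⟨ shift-shift (m ∸ a) b w x ⟩
        shift (m ∸ a + b) w x        ≡⟨ shift-cong w m∸a+b≡b-a x ⟩
        shift b-a w x                ∎)
        where
          open ≡-Reasoning
          m∸a+b≡b-a : m ∸ a + b ≡ₘ b-a
          m∸a+b≡b-a = ≡ₘ-trans (≡⇒≡ₘ (ℕP.+-comm (m ∸ a) b)) (≡ₘ-sym (%-≡ₘ (b + (m ∸ a))))

  Apart : ℕ → ℕ → Set
  Apart a b = a < m × b < m ×
              (InvertibleNat m ((b + (m ∸ a)) % m) ⊎ InvertibleNat m ((a + (m ∸ b)) % m))

  Apart⇒constant : ∀ {a b} w → Apart a b → Constant (shift a w ⊖ shift b w) → Constant w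
  Apart⇒constant {a} {b} w (a<m , b<m , inj₁ b-a-unit) =
    constant-shift-difference⇒constant a b w a<m b-a-unit
  Apart⇒constant {a} {b} w (a<m , b<m , inj₂ a-b-unit) =
    constant-shift-difference⇒constant b a w b<m a-b-unit ∘ Constant-⊖-comm {shift a w} {shift b w}

  -- Complete homogeneous symmetric polynomials

  -- h L k is the complete homogeneous symmetric polynomial h_{k+1-|L|} in the monomials x^a
  -- (a ∈ L); the offset gives access to the negative degrees, where it vanishes.
  h : List ℕ → ℕ → Weights
  h []          _       = 0ʷ
  h (a ∷ L)     (suc k) = h L k ⊕ shift a (h (a ∷ L) k)
  h (_ ∷ [])    zero    = δ
  h (_ ∷ _ ∷ _) zero    = 0ʷ

  h-singleton : ∀ a k → h (a ∷ []) k ≗ shift (k * a) δ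
  h-singleton a zero    x = δ-cong (≡ₘ-sym (≡ₘ-trans (%-≡ₘ (x + 0)) (≡⇒≡ₘ (ℕP.+-identityʳ x))))
  h-singleton a (suc k) x = begin
    0ℤ +ℤ shift a (h (a ∷ []) k) x  ≡⟨ ℤP.+-identityˡ _ ⟩
    shift a (h (a ∷ []) k) x        ≡⟨ h-singleton a k _ ⟩
    shift a (shift (k * a) δ) x     ≡⟨ shift-shift a (k * a) δ x ⟩
    shift (suc k * a) δ x           ∎
    where open ≡-Reasoning

  h-divided-difference : ∀ a b M k →
    shift a (h (a ∷ b ∷ M) k) ⊖ shift b (h (a ∷ b ∷ M) k) ≗ h (a ∷ M) k ⊖ h (b ∷ M) k
  h-divided-difference a b []      zero    x = sym (ℤP.+-inverseʳ (δ x))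
  h-divided-difference a b (_ ∷ _) zero    x = refl
  h-divided-difference a b M       (suc k) x = begin
    (sa B +ℤ sa (shift a H)) -ℤ (sb B +ℤ sb (shift a H))
      ≡⟨ cong (λ z → (sa B +ℤ sa (shift a H)) -ℤ (sb B +ℤ z)) (shift-comm b a H x) ⟩
    (sa B +ℤ sa (shift a H)) -ℤ (sb B +ℤ sa (shift b H))
      ≡⟨ regroup (sa B) (sb B) (sa (shift a H)) (sa (shift b H)) ⟩
    (sa B -ℤ sb B) +ℤ sa (shift a H ⊖ shift b H)
      ≡⟨ cong ((sa B -ℤ sb B) +ℤ_) (h-divided-difference a b M k _) ⟩
    (sa B -ℤ sb B) +ℤ (sa A -ℤ sa B)
      ≡⟨ telescope (sa A) (sa B) (sb B) (h M k x) ⟩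
    (h M k x +ℤ sa A) -ℤ (h M k x +ℤ sb B)
      ∎
    where
      open ≡-Reasoning
      H A B : Weights
      H = h (a ∷ b ∷ M) k
      A = h (a ∷ M) k
      B = h (b ∷ M) k
      sa sb : Weights → ℤ
      sa f = shift a f x
      sb f = shift b f x
      regroup : ∀ u v s t → (u +ℤ s) -ℤ (v +ℤ t) ≡ (u -ℤ v) +ℤ (s -ℤ t)
      regroup = solve-∀
      telescope : ∀ u v w z → (v -ℤ w) +ℤ (u -ℤ v) ≡ (z +ℤ u) -ℤ (z +ℤ w)
      telescope = solve-∀

  module _ {N : ℕ} (N≡0 : N ≡ₘ 0) where

    Δ : List ℕ → ℕ → Weights
    Δ L k = h L (k + N) ⊖ h L k

    Δ-singleton : ∀ a k → Δ (a ∷ []) k ≗ 0ʷ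
    Δ-singleton a k x = begin
      h (a ∷ []) (k + N) x -ℤ h (a ∷ []) k x
        ≡⟨ cong₂ _-ℤ_ (h-singleton a (k + N) x) (h-singleton a k x) ⟩
      shift ((k + N) * a) δ x -ℤ shift (k * a) δ x
        ≡⟨ cong (_-ℤ shift (k * a) δ x) (shift-cong δ (*-congₘ k+N≡k ≡ₘ-refl) x) ⟩
      shift (k * a) δ x -ℤ shift (k * a) δ x
        ≡⟨ ℤP.+-inverseʳ (shift (k * a) δ x) ⟩
      0ℤ
        ∎
      where
        open ≡-Reasoning
        k+N≡k : k + N ≡ₘ k
        k+N≡k = ≡ₘ-trans (+-congₘ {k} ≡ₘ-refl N≡0) (≡⇒≡ₘ (ℕP.+-identityʳ k))

    Δ-divided-difference : ∀ a b M k →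
      shift a (Δ (a ∷ b ∷ M) k) ⊖ shift b (Δ (a ∷ b ∷ M) k) ≗ Δ (a ∷ M) k ⊖ Δ (b ∷ M) k
    Δ-divided-difference a b M k x = begin
      (sa H⁺ -ℤ sa H) -ℤ (sb H⁺ -ℤ sb H)
        ≡⟨ interchange (sa H⁺) (sa H) (sb H⁺) (sb H) ⟩
      (sa H⁺ -ℤ sb H⁺) -ℤ (sa H -ℤ sb H)
        ≡⟨ cong₂ _-ℤ_ (h-divided-difference a b M (k + N) x) (h-divided-difference a b M k x) ⟩
      (A⁺ x -ℤ B⁺ x) -ℤ (A x -ℤ B x)
        ≡⟨ interchange (A⁺ x) (B⁺ x) (A x) (B x) ⟩
      (A⁺ x -ℤ A x) -ℤ (B⁺ x -ℤ B x)
        ∎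
      where
        open ≡-Reasoning
        H⁺ H A⁺ A B⁺ B : Weights
        H⁺ = h (a ∷ b ∷ M) (k + N)
        H  = h (a ∷ b ∷ M) k
        A⁺ = h (a ∷ M) (k + N)
        A  = h (a ∷ M) k
        B⁺ = h (b ∷ M) (k + N)
        B  = h (b ∷ M) k
        sa sb : Weights → ℤ
        sa f = shift a f x
        sb f = shift b f x
        interchange : ∀ u v s t → (u -ℤ v) -ℤ (s -ℤ t) ≡ (u -ℤ s) -ℤ (v -ℤ t)
        interchange = solve-∀

    Δ-constant : ∀ a M → All (Apart a) M → AllPairs Apart M → ∀ k → Constant (Δ (a ∷ M) k)
    Δ-constant a []      _          _               k =
      Constant-resp-≗ₘ (λ {x} _ → sym (Δ-singleton a k x)) (λ _ _ → refl)
    Δ-constant a (b ∷ M) (ab ∷ a-M) (b-M ∷ M-apart) k =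
      Apart⇒constant (Δ (a ∷ b ∷ M) k) ab
        (Constant-resp-≗ₘ (λ {x} _ → sym (Δ-divided-difference a b M k x))
          (Constant-⊖ (Δ-constant a M a-M M-apart k) (Δ-constant b M b-M M-apart k)))

  h-periodic-constant : ∀ {a M} k N → N ≡ₘ 0 → AllPairs Apart (a ∷ M) → h (a ∷ M) k ≗ 0ʷ →
                        Constant (h (a ∷ M) (k + N))
  h-periodic-constant {a} {M} k N N≡0 (a-M ∷ M-apart) h≗0 =
    Constant-resp-≗ₘ Δ≗h (Δ-constant N≡0 a M a-M M-apart k)
    where
      Δ≗h : Δ N≡0 (a ∷ M) k ≗ₘ h (a ∷ M) (k + N)
      Δ≗h {x} _ = trans (cong (h (a ∷ M) (k + N) x -ℤ_) (h≗0 x)) (ℤP.+-identityʳ _)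

  -- The tetrahedron

  layer : ℕ → (ℕ → Weights) → ℕ → Weights
  layer d g t x = ∑ (λ i → shift (i * d) (g (t ∸ i)) x) (upTo t)

  layer-suc : ∀ d g t → layer d g (suc t) ≗ₘ g (suc t) ⊕ shift d (layer d g t)
  layer-suc d g t {x} x<m = begin
    layer d g (suc t) x
      ≡⟨ ∑-upTo-suc (λ i → shift (i * d) (g (suc t ∸ i)) x) t ⟩
    shift 0 (g (suc t)) x +ℤ ∑ (λ i → shift (suc i * d) (g (t ∸ i)) x) (upTo t)
      ≡⟨ cong₂ _+ℤ_ (shift-≡ₘ0 (g (suc t)) ≡ₘ-refl x<m)
                    (∑-cong (λ i → sym (shift-shift d (i * d) (g (t ∸ i)) x)) (upTo t)) ⟩
    g (suc t) x +ℤ shift d (layer d g t) x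
      ∎
    where open ≡-Reasoning

  layer≗h : ∀ d L e g → h (d ∷ L) e ≗ 0ʷ → (∀ t → g (suc t) ≗ₘ h L (e + t)) →
            ∀ t → layer d g t ≗ₘ h (d ∷ L) (e + t)
  layer≗h d L e g h≗0 g≗h zero    {x} _   =
    sym (trans (cong (λ n → h (d ∷ L) n x) (ℕP.+-identityʳ e)) (h≗0 x))
  layer≗h d L e g h≗0 g≗h (suc t) {x} x<m = begin
    layer d g (suc t) x
      ≡⟨ layer-suc d g t x<m ⟩
    g (suc t) x +ℤ shift d (layer d g t) x
      ≡⟨ cong₂ _+ℤ_ (g≗h t x<m) (shift-resp-≗ₘ d (layer≗h d L e g h≗0 g≗h t) x) ⟩
    h (d ∷ L) (suc (e + t)) x
      ≡⟨ cong (λ n → h (d ∷ L) n x) (ℕP.+-suc e t) ⟨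
    h (d ∷ L) (e + suc t) x
      ∎
    where open ≡-Reasoning

  tetrahedron : ℕ → ℕ → ℕ → ℕ → Weights
  tetrahedron d₁ d₂ d₃ = layer d₁ (layer d₂ (layer d₃ (λ _ → δ)))

  tetrahedron≗h : ∀ d₁ d₂ d₃ s →
                  tetrahedron d₁ d₂ d₃ s ≗ₘ h (d₁ ∷ d₂ ∷ d₃ ∷ 0 ∷ []) (2 + s)
  tetrahedron≗h d₁ d₂ d₃ = layer≗h d₁ (d₂ ∷ d₃ ∷ 0 ∷ []) 2 g₂ (λ _ → refl) (level₂ ∘ suc)
    where
      g₁ g₂ : ℕ → Weights
      g₁ = layer d₃ (λ _ → δ)
      g₂ = layer d₂ g₁
      point-mass : ∀ t → δ ≗ₘ h (0 ∷ []) t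
      point-mass t {x} x<m = sym (trans (h-singleton 0 t x) (shift-≡ₘ0 δ (≡⇒≡ₘ (ℕP.*-zeroʳ t)) x<m))
      level₁ : ∀ t → g₁ t ≗ₘ h (d₃ ∷ 0 ∷ []) (0 + t)
      level₁ = layer≗h d₃ (0 ∷ []) 0 (λ _ → δ) (λ _ → refl) point-mass
      level₂ : ∀ t → g₂ t ≗ₘ h (d₂ ∷ d₃ ∷ 0 ∷ []) (1 + t)
      level₂ = layer≗h d₂ (d₃ ∷ 0 ∷ []) 1 g₁ (λ _ → refl) (level₁ ∘ suc)

  tetrahedron-constant : ∀ {d₁ d₂ d₃} → AllPairs Apart (d₁ ∷ d₂ ∷ d₃ ∷ 0 ∷ []) →
    ∀ s → s % m ≡ 0 ⊎ (s + 1) % m ≡ 0 ⊎ (s + 2) % m ≡ 0 → Constant (tetrahedron d₁ d₂ d₃ s)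
  tetrahedron-constant {d₁} {d₂} {d₃} apart s s≡0,-1,-2 =
    Constant-resp-≗ₘ (λ x<m → sym (tetrahedron≗h d₁ d₂ d₃ s x<m)) (h-constant s≡0,-1,-2)
    where
      L : List ℕ
      L = d₁ ∷ d₂ ∷ d₃ ∷ 0 ∷ []
      -- 2 + s = k + N with N ≡ 0 (mod m) and k ≤ 2, where h L k = 0.
      h-constant : s % m ≡ 0 ⊎ (s + 1) % m ≡ 0 ⊎ (s + 2) % m ≡ 0 → Constant (h L (2 + s))
      h-constant (inj₁ s≡0) =
        h-periodic-constant 2 s ⟨ s≡0 ⟩ apart (λ _ → refl)
      h-constant (inj₂ (inj₁ s+1≡0)) =
        subst (Constant ∘ h L) (cong suc (ℕP.+-comm s 1))
          (h-periodic-constant 1 (s + 1) ⟨ s+1≡0 ⟩ apart (λ _ → refl))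
      h-constant (inj₂ (inj₂ s+2≡0)) =
        subst (Constant ∘ h L) (ℕP.+-comm s 2)
          (h-periodic-constant 0 (s + 2) ⟨ s+2≡0 ⟩ apart (λ _ → refl))

  count-AS : ∀ (a d₁ d₂ d₃ : Fin m) s {c} → c < m →
    ℤ.+ count c (AS m a d₁ d₂ d₃ s) ≡ shift (toℕ a) (tetrahedron (toℕ d₁) (toℕ d₂) (toℕ d₃) s) c
  count-AS a d₁ d₂ d₃ s {c} c<m = begin
    ℤ.+ count c (AS m a d₁ d₂ d₃ s)     ≡⟨ count-map c (asElem m a d₁ d₂ d₃) (indices s) ⟩
    ∑ φ (indices s)                     ≡⟨ ∑-concatMap φ rows₁ (upTo s) ⟩
    ∑ (∑ φ ∘ rows₁) (upTo s)            ≡⟨ ∑-cong level₁ (upTo s) ⟩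
    shift A (tetrahedron D₁ D₂ D₃ s) c  ∎
    where
      open ≡-Reasoning
      A D₁ D₂ D₃ : ℕ
      A  = toℕ a
      D₁ = toℕ d₁
      D₂ = toℕ d₂
      D₃ = toℕ d₃

      φ : ℕ × ℕ × ℕ → ℤ
      φ i = indicator (does (asElem m a d₁ d₂ d₃ i ≟ c))

      rows₂ : ℕ → ℕ → List (ℕ × ℕ × ℕ)
      rows₂ i₁ i₂ = map (λ i₃ → (i₁ , i₂ , i₃)) (upTo (s ∸ (i₁ + i₂)))

      rows₁ : ℕ → List (ℕ × ℕ × ℕ)
      rows₁ i₁ = concatMap (rows₂ i₁) (upTo (s ∸ i₁))

      point : ∀ i₁ i₂ i₃ →
        φ (i₁ , i₂ , i₃) ≡ shift A (shift (i₁ * D₁) (shift (i₂ * D₂) (shift (i₃ * D₃) δ))) c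
      point i₁ i₂ i₃ = begin
        φ (i₁ , i₂ , i₃)
          ≡⟨ indicator-%≟ (A + i₁ * D₁ + i₂ * D₂ + i₃ * D₃) c<m ⟩
        shift (A + i₁ * D₁ + i₂ * D₂ + i₃ * D₃) δ c
          ≡⟨ shift-shift (A + i₁ * D₁ + i₂ * D₂) (i₃ * D₃) δ c ⟨
        shift (A + i₁ * D₁ + i₂ * D₂) (shift (i₃ * D₃) δ) c
          ≡⟨ shift-shift (A + i₁ * D₁) (i₂ * D₂) (shift (i₃ * D₃) δ) c ⟨
        shift (A + i₁ * D₁) (shift (i₂ * D₂) (shift (i₃ * D₃) δ)) c
          ≡⟨ shift-shift A (i₁ * D₁) (shift (i₂ * D₂) (shift (i₃ * D₃) δ)) c ⟨
        shift A (shift (i₁ * D₁) (shift (i₂ * D₂) (shift (i₃ * D₃) δ))) c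
          ∎

      level₂ : ∀ i₁ i₂ → ∑ φ (rows₂ i₁ i₂)
             ≡ shift A (shift (i₁ * D₁) (shift (i₂ * D₂) (layer D₃ (λ _ → δ) (s ∸ i₁ ∸ i₂)))) c
      level₂ i₁ i₂ = begin
        ∑ φ (rows₂ i₁ i₂)
          ≡⟨ ∑-map φ (λ i₃ → (i₁ , i₂ , i₃)) (upTo (s ∸ (i₁ + i₂))) ⟩
        ∑ (λ i₃ → φ (i₁ , i₂ , i₃)) (upTo (s ∸ (i₁ + i₂)))
          ≡⟨ cong (λ n → ∑ (λ i₃ → φ (i₁ , i₂ , i₃)) (upTo n)) (ℕP.∸-+-assoc s i₁ i₂) ⟨
        ∑ (λ i₃ → φ (i₁ , i₂ , i₃)) (upTo (s ∸ i₁ ∸ i₂))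
          ≡⟨ ∑-cong (point i₁ i₂) (upTo (s ∸ i₁ ∸ i₂)) ⟩
        shift A (shift (i₁ * D₁) (shift (i₂ * D₂) (layer D₃ (λ _ → δ) (s ∸ i₁ ∸ i₂)))) c
          ∎

      level₁ : ∀ i₁ → ∑ φ (rows₁ i₁)
             ≡ shift A (shift (i₁ * D₁) (layer D₂ (layer D₃ (λ _ → δ)) (s ∸ i₁))) c
      level₁ i₁ =
        trans (∑-concatMap φ (rows₂ i₁) (upTo (s ∸ i₁))) (∑-cong (level₂ i₁) (upTo (s ∸ i₁)))

  Invertible⇒Apart-0 : ∀ {d : Fin m} → Invertible m d → Apart (toℕ d) 0
  Invertible⇒Apart-0 {d} (y , dy≡1) =
    toℕ<n d , 0<m , inj₂ (toℕ y , %-≡ (≡ₘ-trans (*-congₘ d+m≡d ≡ₘ-refl) (⟨_⟩ {y = 1} dy≡1)))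
    where
      d+m≡d : (toℕ d + (m ∸ 0)) % m ≡ₘ toℕ d
      d+m≡d = ≡ₘ-trans (%-≡ₘ (toℕ d + m)) ⟨ [m+n]%n≡m%n (toℕ d) m ⟩

  pairwise-apart : ∀ {d₁ d₂ d₃ : Fin m} →
    Invertible m d₁ → Invertible m d₂ → Invertible m d₃ →
    InvertibleNat m (diff m d₂ d₁) → InvertibleNat m (diff m d₃ d₂) →
    InvertibleNat m (diff m d₁ d₃) →
    AllPairs Apart (toℕ d₁ ∷ toℕ d₂ ∷ toℕ d₃ ∷ 0 ∷ [])
  pairwise-apart {d₁} {d₂} {d₃} u₁ u₂ u₃ u₁₂ u₂₃ u₃₁ =
      ((d₁<m , d₂<m , inj₁ u₁₂) ∷ (d₁<m , d₃<m , inj₂ u₃₁) ∷ Invertible⇒Apart-0 u₁ ∷ [])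
    ∷ ((d₂<m , d₃<m , inj₁ u₂₃) ∷ Invertible⇒Apart-0 u₂ ∷ [])
    ∷ (Invertible⇒Apart-0 u₃ ∷ [])
    ∷ []
    ∷ []
    where
      d₁<m : toℕ d₁ < m
      d₁<m = toℕ<n d₁
      d₂<m : toℕ d₂ < m
      d₂<m = toℕ<n d₂
      d₃<m : toℕ d₃ < m
      d₃<m = toℕ<n d₃

theorem3p14 : (m : ℕ) → .{{_ : NonZero m}} → m % 2 ≡ 1 → ¬ (m % 3 ≡ 0) →
    (a d₁ d₂ d₃ : Fin m) →
    Invertible m d₁ → Invertible m d₂ → Invertible m d₃ →
    InvertibleNat m (diff m d₂ d₁) → InvertibleNat m (diff m d₃ d₂) →
    InvertibleNat m (diff m d₁ d₃) →
    (s : ℕ) → 1 ≤ s →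
    (s % m ≡ 0 ⊎ (s + 1) % m ≡ 0 ⊎ (s + 2) % m ≡ 0) →
    Balanced m (AS m a d₁ d₂ d₃ s)
theorem3p14 zero ()
theorem3p14 (suc p) _ _ a d₁ d₂ d₃ u₁ u₂ u₃ u₁₂ u₂₃ u₃₁ s _ s≡0,-1,-2 c c′ =
  ℤP.+-injective (begin
    ℤ.+ count (toℕ c) (AS m a d₁ d₂ d₃ s)   ≡⟨ count-AS a d₁ d₂ d₃ s (toℕ<n c) ⟩
    shift (toℕ a) T (toℕ c)                 ≡⟨ Constant-shift (toℕ a) T-constant (toℕ<n c) (toℕ<n c′) ⟩
    shift (toℕ a) T (toℕ c′)                ≡⟨ count-AS a d₁ d₂ d₃ s (toℕ<n c′) ⟨
    ℤ.+ count (toℕ c′) (AS m a d₁ d₂ d₃ s)  ∎)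
  where
    open Residues p
    open ≡-Reasoning
    T : Weights
    T = tetrahedron (toℕ d₁) (toℕ d₂) (toℕ d₃) s
    T-constant : Constant T
    T-constant = tetrahedron-constant (pairwise-apart u₁ u₂ u₃ u₁₂ u₂₃ u₃₁) s s≡0,-1,-2
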